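{- Let $U$ be a finite set and let $\mathbb{Y}$ be a coherent preference list on $U$ with induced choice function $f=f_{\mathbb{Y}}$. Then $f$ is not substitutable if and only if there exist members $X,Y$ of $\mathbb{Y}$ with $X \succ Y$ and $f(X\cup Y)=X$ such that some $x \in X\setminus Y$ satisfies $f(Y\cup\{x\})=Y$ (i.e. there is a witness to non-substitutability).
   Context: A choice function on a finite set $U$ is a map $f$ from subsets of $U$ to subsets of $U$ with $f(A)\subseteq A$ for all $A\subseteq U$. It is substitutable if for all $A\subseteq B\subseteq U$ one has $f(B)\cap A\subseteq f(A)$. A preference list $\mathbb{Y}$ on $U$ is an ordered finite list of subsets of $U$ whose last element is the empty set; for members $X,Y$ we write $X\succ Y$ if $X$ properly precedes $Y$ in the list and $X\succeq Y$ if $X\succ Y$ or $X=Y$. The induced choice function $f_{\mathbb{Y}}$ maps $A\subseteq U$ to the first member of $\mathbb{Y}$ contained in $A$. $\mathbb{Y}$ is coherent if for any two members, $X\succ Y$ implies $X\not\subseteq Y$. A witness to non-substitutability is a pair $(X,Y)$ of members of $\mathbb{Y}$ with $X\succ Y$, $f(X\cup Y)=X$, and some $x\in X\setminus Y$ with $f(Y\cup\{x\})=Y$. -}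

module Defs where

open import Data.Nat using (ℕ; _<_)
open import Data.Fin using (Fin)
import Data.Fin as F
open import Data.Fin.Subset using (Subset; ⊥; _⊆_; _∩_; _∪_; _∈_; _∉_; ⁅_⁆)
open import Data.Fin.Subset.Properties using (_⊆?_; ∉⊥)
open import Data.Empty using (⊥-elim)
open import Data.List using (List; []; _∷_; _++_; [_]; length; lookup)
open import Data.Product using (Σ; ∃; _×_; _,_)
open import Relation.Nullary using (¬_; yes; no)
open import Relation.Binary.PropositionalEquality using (_≡_)

record ChoiceFunction (n : ℕ) : Set where
  field
    apply  : Subset n → Subset n
    choose : ∀ A → apply A ⊆ A
open ChoiceFunction public

Substitutable : ∀ {n} → ChoiceFunction n → Set
Substitutable f = ∀ A B → A ⊆ B → apply f B ∩ A ⊆ apply f A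

record PreferenceList (n : ℕ) : Set where
  field
    members  : List (Subset n)
    lastEmpty : ∃ λ ys → members ≡ ys ++ [ ⊥ ]
open PreferenceList public

Pos : ∀ {n} → PreferenceList n → Set
Pos Y = Fin (length (members Y))

_at_ : ∀ {n} (Y : PreferenceList n) → Pos Y → Subset n
Y at i = lookup (members Y) i

-- Member X ≻ member Y: X (at position i) properly precedes Y (at position j), i.e. i < j.
-- Coherence: X ≻ Y implies X ⊈ Y.
Coherent : ∀ {n} → PreferenceList n → Set
Coherent Y = ∀ (i j : Pos Y) → i F.< j → ¬ ((Y at i) ⊆ (Y at j))

-- First member of a list contained in A (∅ if none; for a preference list the
-- last member is ∅, so some member is always contained in A).
firstIn : ∀ {n} → List (Subset n) → Subset n → Subset n
firstIn []       A = ⊥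
firstIn (X ∷ Xs) A with X ⊆? A
... | yes _ = X
... | no  _ = firstIn Xs A

induced : ∀ {n} → PreferenceList n → Subset n → Subset n
induced Y A = firstIn (members Y) A

induced⊆ : ∀ {n} (Y : PreferenceList n) A → induced Y A ⊆ A
induced⊆ Y A = go (members Y)
  where
  go : ∀ Xs → firstIn Xs A ⊆ A
  go []       x∈ = ⊥-elim (∉⊥ x∈)
  go (X ∷ Xs) with X ⊆? A
  ... | yes p = p
  ... | no  _ = go Xs

fChoice : ∀ {n} → PreferenceList n → ChoiceFunction n
fChoice Y = record { apply = induced Y ; choose = induced⊆ Y }

Witness : ∀ {n} → PreferenceList n → Set
Witness {n} Y =
  Σ (Pos Y) λ i → Σ (Pos Y) λ j →
    i F.< j ×
    induced Y ((Y at i) ∪ (Y at j)) ≡ (Y at i) ×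
    Σ (Fin n) λ x → x ∈ (Y at i) × x ∉ (Y at j) ×
      induced Y ((Y at j) ∪ ⁅ x ⁆) ≡ (Y at j)

-- Everything rests on one notion: position i is *first in A*
-- when the member at i is contained in A and no earlier member is.
--
-- (⇐) A witness (X, Y, x) violates substitutability for A = Y ∪ {x} ⊆ X ∪ Y.
-- (⇒) Conversely, let A ⊆ B and y ∈ f(B) ∩ A with y ∉ f(A).  If f(B) = X_i and
-- f(A) = X_j then i < j, and (X_i, X_j, y) is a witness.  Hence "no witness"
-- implies substitutability; since witnesses are decidable, this contrapositive
-- gives the forward direction constructively.
module Submission where

open import Defs
open import Data.Nat using (ℕ; s≤s; z≤n)
open import Data.Product using (_×_)
open import Relation.Nullary using (¬_)

import Data.Nat.Properties as ℕ
import Data.Bool.Properties as Bool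
open import Data.Fin using (Fin; zero; suc)
import Data.Fin as F
import Data.Fin.Properties as FP
open import Data.Fin.Subset using (Subset; ⊥; _⊆_; _∩_; _∪_; _∈_; _∉_; ⁅_⁆)
open import Data.Fin.Subset.Properties
  using (_⊆?_; _∈?_; ⊥⊆; p⊆p∪q; q⊆p∪q; x∈p∩q⁺; x∈p∩q⁻; x∈p∪q⁻; x∈⁅x⁆; x∈⁅y⁆⇒x≡y)
open import Data.List using (List; []; _∷_; _++_; [_]; length; lookup)
open import Data.List.Relation.Unary.Any using (Any; here; there)
open import Data.Product using (Σ; _,_)
open import Data.Sum using (inj₁; inj₂)
open import Data.Empty using (⊥-elim)
open import Data.Vec.Properties using (≡-dec)
open import Relation.Nullary using (Dec; yes; no; ¬?)
open import Relation.Nullary.Decidable using (_×-dec_)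
open import Relation.Binary.Definitions using (DecidableEquality)
open import Relation.Binary.PropositionalEquality using (_≡_; _≢_; refl; sym; trans; subst)

module _ {n : ℕ} where

  ∪-least : ∀ {p q r : Subset n} → p ⊆ r → q ⊆ r → p ∪ q ⊆ r
  ∪-least {p} {q} p⊆r q⊆r x∈p∪q with x∈p∪q⁻ p q x∈p∪q
  ... | inj₁ x∈p = p⊆r x∈p
  ... | inj₂ x∈q = q⊆r x∈q

  ⁅⁆-least : ∀ {x : Fin n} {p : Subset n} → x ∈ p → ⁅ x ⁆ ⊆ p
  ⁅⁆-least {x} x∈p y∈⁅x⁆ = subst (_∈ _) (sym (x∈⁅y⁆⇒x≡y x y∈⁅x⁆)) x∈p

  _≟ˢ_ : DecidableEquality (Subset n)
  _≟ˢ_ = ≡-dec Bool._≟_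

  record IsFirst (Xs : List (Subset n)) (A : Subset n) (i : Fin (length Xs)) : Set where
    constructor _,_
    field
      member⊆  : lookup Xs i ⊆ A
      earlier⊈ : ∀ k → k F.< i → ¬ (lookup Xs k ⊆ A)
  open IsFirst

  first-exists : ∀ (Xs : List (Subset n)) A → Any (_⊆ A) Xs →
    Σ (Fin (length Xs)) (IsFirst Xs A)
  first-exists (X ∷ Xs) A some with X ⊆? A
  ... | yes X⊆A = zero , X⊆A , λ _ ()
  ... | no X⊈A with some
  ...   | here X⊆A = ⊥-elim (X⊈A X⊆A)
  ...   | there some′ with first-exists Xs A some′
  ...     | i , Xi⊆A , earlier = suc i , Xi⊆A , λ
    { zero    _         → X⊈A
    ; (suc k) (s≤s k<i) → earlier k k<i }

  firstIn-first : ∀ (Xs : List (Subset n)) A i → IsFirst Xs A i →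
    firstIn Xs A ≡ lookup Xs i
  firstIn-first (X ∷ Xs) A i (Xi⊆A , earlier) with X ⊆? A | i
  ... | yes _    | zero  = refl
  ... | yes X⊆A  | suc _ = ⊥-elim (earlier zero (s≤s z≤n) X⊆A)
  ... | no X⊈A   | zero  = ⊥-elim (X⊈A Xi⊆A)
  ... | no _     | suc i = firstIn-first Xs A i
    (Xi⊆A , λ k k<i → earlier (suc k) (s≤s k<i))

  first-restrict : ∀ {Xs A C i} → IsFirst Xs A i →
    lookup Xs i ⊆ C → C ⊆ A → IsFirst Xs C i
  first-restrict (_ , earlier) Xi⊆C C⊆A =
    Xi⊆C , λ k k<i Xk⊆C → earlier k k<i (λ x∈Xk → C⊆A (Xk⊆C x∈Xk))

  first-antitone : ∀ {Xs A B i j} → A ⊆ B →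
    IsFirst Xs B i → IsFirst Xs A j → i F.≤ j
  first-antitone A⊆B (_ , earlierB) (Xj⊆A , _) =
    ℕ.≮⇒≥ (λ j<i → earlierB _ j<i (λ x∈Xj → A⊆B (Xj⊆A x∈Xj)))

  some-member⊆ : (Y : PreferenceList n) (A : Subset n) → Any (_⊆ A) (members Y)
  some-member⊆ Y A with lastEmpty Y
  ... | ys , members≡ = subst (Any (_⊆ A)) (sym members≡) (∅-last ys)
    where
    ∅-last : ∀ ys → Any (_⊆ A) (ys ++ [ ⊥ ])
    ∅-last []       = here ⊥⊆
    ∅-last (_ ∷ ys) = there (∅-last ys)

  first : (Y : PreferenceList n) (A : Subset n) →
    Σ (Pos Y) λ i → IsFirst (members Y) A i × induced Y A ≡ Y at i
  first Y A with first-exists (members Y) A (some-member⊆ Y A)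
  ... | i , isFirst = i , isFirst , firstIn-first (members Y) A i isFirst

  witness? : (Y : PreferenceList n) → Dec (Witness Y)
  witness? Y = FP.any? λ i → FP.any? λ j → (i FP.<? j) ×-dec
    (induced Y ((Y at i) ∪ (Y at j)) ≟ˢ (Y at i)) ×-dec
    FP.any? λ x → (x ∈? (Y at i)) ×-dec ¬? (x ∈? (Y at j)) ×-dec
      (induced Y ((Y at j) ∪ ⁅ x ⁆) ≟ˢ (Y at j))

  witness⇒¬substitutable : (Y : PreferenceList n) →
    Witness Y → ¬ Substitutable (fChoice Y)
  witness⇒¬substitutable Y (i , j , _ , fB≡Xi , x , x∈Xi , x∉Xj , fA≡Xj) sub =
    x∉Xj (subst (x ∈_) fA≡Xj (sub A B A⊆B x∈fB∩A))
    where
    A B : Subset n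
    A = (Y at j) ∪ ⁅ x ⁆
    B = (Y at i) ∪ (Y at j)
    A⊆B : A ⊆ B
    A⊆B = ∪-least (q⊆p∪q (Y at i) (Y at j)) (⁅⁆-least (p⊆p∪q (Y at j) x∈Xi))
    x∈fB∩A : x ∈ induced Y B ∩ A
    x∈fB∩A = x∈p∩q⁺ (subst (x ∈_) (sym fB≡Xi) x∈Xi , q⊆p∪q (Y at j) ⁅ x ⁆ (x∈⁅x⁆ x))

  -- (⇒) Every violation of substitutability yields a witness: with f(B) = X_i
  -- and f(A) = X_j we get i < j, X_i is first in X_i ∪ X_j ⊆ B and X_j is
  -- first in X_j ∪ {y} ⊆ A.
  violation⇒witness : (Y : PreferenceList n) {A B : Subset n} {y : Fin n} →
    A ⊆ B → y ∈ induced Y B → y ∈ A → y ∉ induced Y A → Witness Y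
  violation⇒witness Y {A} {B} {y} A⊆B y∈fB y∈A y∉fA
    with first Y B | first Y A
  ... | i , firstB , fB≡Xi | j , firstA , fA≡Xj =
    i , j , i<j , fXi∪Xj≡Xi , y , y∈Xi , y∉Xj , fXj∪y≡Xj
    where
    y∈Xi : y ∈ Y at i
    y∈Xi = subst (y ∈_) fB≡Xi y∈fB
    y∉Xj : y ∉ Y at j
    y∉Xj y∈Xj = y∉fA (subst (y ∈_) (sym fA≡Xj) y∈Xj)
    i≢j : i ≢ j
    i≢j refl = y∉fA (subst (y ∈_) (trans fB≡Xi (sym fA≡Xj)) y∈fB)
    i<j : i F.< j
    i<j = FP.≤∧≢⇒< (first-antitone A⊆B firstB firstA) i≢j
    Xj⊆A : Y at j ⊆ A
    Xj⊆A = member⊆ firstA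
    fXi∪Xj≡Xi : induced Y ((Y at i) ∪ (Y at j)) ≡ Y at i
    fXi∪Xj≡Xi = firstIn-first (members Y) _ i (first-restrict firstB
      (p⊆p∪q (Y at j)) (∪-least (member⊆ firstB) (λ x∈Xj → A⊆B (Xj⊆A x∈Xj))))
    fXj∪y≡Xj : induced Y ((Y at j) ∪ ⁅ y ⁆) ≡ Y at j
    fXj∪y≡Xj = firstIn-first (members Y) _ j (first-restrict firstA
      (p⊆p∪q ⁅ y ⁆) (∪-least Xj⊆A (⁅⁆-least y∈A)))

  ¬witness⇒substitutable : (Y : PreferenceList n) →
    ¬ Witness Y → Substitutable (fChoice Y)
  ¬witness⇒substitutable Y noWitness A B A⊆B {y} y∈fB∩A with y ∈? induced Y A
  ... | yes y∈fA = y∈fA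
  ... | no y∉fA with x∈p∩q⁻ (induced Y B) A y∈fB∩A
  ...   | y∈fB , y∈A = ⊥-elim (noWitness (violation⇒witness Y A⊆B y∈fB y∈A y∉fA))

theorem1 : ∀ {n : ℕ} (Y : PreferenceList n) → Coherent Y →
    ((¬ Substitutable (fChoice Y)) → Witness Y) × (Witness Y → ¬ Substitutable (fChoice Y))
theorem1 Y _ = ¬substitutable⇒witness , witness⇒¬substitutable Y
  where
  ¬substitutable⇒witness : ¬ Substitutable (fChoice Y) → Witness Y
  ¬substitutable⇒witness notSub with witness? Y
  ... | yes w  = w
  ... | no ¬w = ⊥-elim (notSub (¬witness⇒substitutable Y ¬w))
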